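{- If $d=2^k+1$ for some integer $k\geq 2$, then $A_{\mathbf{r}}(0,d)=(d+1)/2$.
   Context: For $n\in\mathbb{N}$, $e_{11}(n)$ is the number of (possibly overlapping) occurrences of $11$ in the binary expansion of $n$, and $r_n=e_{11}(n)\bmod 2$. For $d\geq 1$, $A_{\mathbf{r}}(0,d)=\inf\{l\geq 1: r_{ld}\neq r_0\}$. -}

module Defs where

open import Data.Nat using (ℕ; zero; suc; _+_; _*_; _≤_; _<_; _%_; _/_)
open import Data.Bool using (Bool; true; false)
open import Relation.Binary.PropositionalEquality using (_≡_)
open import Relation.Nullary using (¬_)
open import Data.Product using (_×_)

-- e11 with fuel: counts occurrences of the block 11 in the binary
-- expansion of n, i.e. the number of i with bits i and i+1 of n both 1.
-- Fuel n suffices since n / 2 < n for n ≥ 1.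
e11-fuel : ℕ → ℕ → ℕ
e11-fuel zero n = 0
e11-fuel (suc f) n with n % 2 | (n / 2) % 2
... | 1 | 1 = suc (e11-fuel f (n / 2))
... | _ | _ = e11-fuel f (n / 2)

e11 : ℕ → ℕ
e11 n = e11-fuel n n

r : ℕ → ℕ
r n = e11 n % 2

-- A_r(0,d) = m  iff  m is the infimum of {l ≥ 1 : r_{l d} ≠ r_0}
-- (the least element of that set).
IsA0 : ℕ → ℕ → Set
IsA0 d m = (1 ≤ m) × ¬ (r (m * d) ≡ r 0) × (∀ l → 1 ≤ l → l < m → r (l * d) ≡ r 0)

-- Writing n·d = n·2^k + n, the two copies of the binary expansion of n do not
-- overlap as long as n < 2^(k-1), so e₁₁(n·d) = 2·e₁₁(n) is even; for
-- n = 2^(k-1) the product is d shifted, with e₁₁(d) = 0.  The next multiple,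
-- (2^(k-1) + 1)·d = 2^(2k-1) + 3·2^(k-1) + 1, has the single block 11
-- (for k ≥ 3; the case k = 2, d = 5 is checked by evaluation).
module Submission where

open import Defs
open import Data.Nat using (ℕ; zero; suc; _+_; _*_; _^_; _%_; _/_; _≤_; _<_; z≤n; s≤s)
open import Data.Nat.Properties
open import Data.Nat.DivMod
open import Data.Nat.Tactic.RingSolver using (solve-∀)
open import Data.Sum using (inj₁; inj₂)
open import Data.Product using (_,_)
open import Relation.Nullary using (¬_; contradiction)
open import Relation.Binary.PropositionalEquality
open import Algebra.Properties.CommutativeSemigroup +-commutativeSemigroup using (x∙yz≈y∙xz)
open ≡-Reasoning

[q*2]%2≡0 : ∀ q → q * 2 % 2 ≡ 0
[q*2]%2≡0 q = m*n%n≡0 q 2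

[q*2]/2≡q : ∀ q → q * 2 / 2 ≡ q
[q*2]/2≡q q = m*n/n≡m q 2

[1+q*2]%2≡1 : ∀ q → (1 + q * 2) % 2 ≡ 1
[1+q*2]%2≡1 q = [m+kn]%n≡m%n 1 q 2

[1+q*2]/2≡q : ∀ q → (1 + q * 2) / 2 ≡ q
[1+q*2]/2≡q q = begin
  (1 + q * 2) / 2 ≡⟨ +-distrib-/ 1 (q * 2) 1+[q*2]%2<2 ⟩
  0 + q * 2 / 2   ≡⟨ [q*2]/2≡q q ⟩
  q               ∎
  where
  1+[q*2]%2<2 : 1 + q * 2 % 2 < 2
  1+[q*2]%2<2 rewrite [q*2]%2≡0 q = s≤s (s≤s z≤n)

n≤1+f⇒n/2≤f : ∀ {n f} → n ≤ suc f → n / 2 ≤ f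
n≤1+f⇒n/2≤f {zero}  _         = z≤n
n≤1+f⇒n/2≤f {suc n} (s≤s n≤f) = ≤-trans (<⇒≤pred (m/n<m (suc n) 2 (s≤s (s≤s z≤n)))) n≤f

q*2<2*p⇒q<p : ∀ q p → q * 2 < 2 * p → q < p
q*2<2*p⇒q<p q p lt = *-cancelʳ-< 2 q p (subst (q * 2 <_) (*-comm 2 p) lt)

data Halves : ℕ → Set where
  twice   : ∀ q → Halves (q * 2)
  twice+1 : ∀ q → Halves (1 + q * 2)

halves : ∀ n → Halves n
halves zero = twice 0
halves (suc n) with halves n
... | twice q   = twice+1 q
... | twice+1 q = twice (suc q)

ends-in-11 : ℕ → ℕ
ends-in-11 n = n % 2 * (n / 2 % 2)

e11-fuel-suc : ∀ f n → e11-fuel (suc f) n ≡ ends-in-11 n + e11-fuel f (n / 2)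
e11-fuel-suc f n with n % 2 | n / 2 % 2 | m%n<n n 2 | m%n<n (n / 2) 2
... | 0           | _           | _             | _             = refl
... | 1           | 0           | _             | _             = refl
... | 1           | 1           | _             | _             = refl
... | 1           | suc (suc _) | _             | s≤s (s≤s ())
... | suc (suc _) | _           | s≤s (s≤s ()) | _

e11-fuel-zero : ∀ f → e11-fuel f 0 ≡ 0
e11-fuel-zero zero    = refl
e11-fuel-zero (suc f) = e11-fuel-zero f

e11-fuel-irrelevant : ∀ f g n → n ≤ f → n ≤ g → e11-fuel f n ≡ e11-fuel g n
e11-fuel-irrelevant zero    g       zero _ _ = sym (e11-fuel-zero g)
e11-fuel-irrelevant (suc f) zero    zero _ _ = e11-fuel-zero (suc f)
e11-fuel-irrelevant (suc f) (suc g) n n≤f n≤g = begin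
  e11-fuel (suc f) n                  ≡⟨ e11-fuel-suc f n ⟩
  ends-in-11 n + e11-fuel f (n / 2)   ≡⟨ cong (ends-in-11 n +_) halves-agree ⟩
  ends-in-11 n + e11-fuel g (n / 2)   ≡⟨ e11-fuel-suc g n ⟨
  e11-fuel (suc g) n                  ∎
  where
  halves-agree : e11-fuel f (n / 2) ≡ e11-fuel g (n / 2)
  halves-agree = e11-fuel-irrelevant f g (n / 2) (n≤1+f⇒n/2≤f n≤f) (n≤1+f⇒n/2≤f n≤g)

e11-unfold : ∀ n → e11 n ≡ ends-in-11 n + e11 (n / 2)
e11-unfold n = begin
  e11-fuel n n                        ≡⟨ e11-fuel-irrelevant n (suc n) n ≤-refl (n≤1+n n) ⟩
  e11-fuel (suc n) n                  ≡⟨ e11-fuel-suc n n ⟩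
  ends-in-11 n + e11-fuel n (n / 2)   ≡⟨ cong (ends-in-11 n +_) (e11-fuel-irrelevant n (n / 2) (n / 2) (m/n≤m n 2) ≤-refl) ⟩
  ends-in-11 n + e11 (n / 2)          ∎

e11-double : ∀ q → e11 (q * 2) ≡ e11 q
e11-double q = begin
  e11 (q * 2)                               ≡⟨ e11-unfold (q * 2) ⟩
  ends-in-11 (q * 2) + e11 (q * 2 / 2)      ≡⟨ cong₂ (λ b h → b * (h % 2) + e11 h) ([q*2]%2≡0 q) ([q*2]/2≡q q) ⟩
  e11 q                                     ∎

e11-double+1 : ∀ q → e11 (1 + q * 2) ≡ q % 2 + e11 q
e11-double+1 q = begin
  e11 (1 + q * 2)                                   ≡⟨ e11-unfold (1 + q * 2) ⟩
  ends-in-11 (1 + q * 2) + e11 ((1 + q * 2) / 2)    ≡⟨ cong₂ (λ b h → b * (h % 2) + e11 h) ([1+q*2]%2≡1 q) ([1+q*2]/2≡q q) ⟩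
  1 * (q % 2) + e11 q                               ≡⟨ cong (_+ e11 q) (*-identityˡ (q % 2)) ⟩
  q % 2 + e11 q                                     ∎

e11-2^* : ∀ t n → e11 (2 ^ t * n) ≡ e11 n
e11-2^* zero    n = cong e11 (+-identityʳ n)
e11-2^* (suc t) n = begin
  e11 (2 * 2 ^ t * n)   ≡⟨ cong e11 (reassoc (2 ^ t) n) ⟩
  e11 (2 ^ t * n * 2)   ≡⟨ e11-double (2 ^ t * n) ⟩
  e11 (2 ^ t * n)       ≡⟨ e11-2^* t n ⟩
  e11 n                 ∎
  where
  reassoc : ∀ p n → 2 * p * n ≡ p * n * 2
  reassoc = solve-∀

-- Since a < 2^j, bit j of b·2^(j+1) + a is 0, so no block 11 straddles the two parts.
e11-concat : ∀ j b a → a < 2 ^ j → e11 (b * 2 ^ suc j + a) ≡ e11 b + e11 a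
e11-concat zero b zero _ = begin
  e11 (b * 2 + 0)   ≡⟨ cong e11 (+-identityʳ (b * 2)) ⟩
  e11 (b * 2)       ≡⟨ e11-double b ⟩
  e11 b             ≡⟨ +-identityʳ (e11 b) ⟨
  e11 b + 0         ∎
e11-concat zero    b (suc a) (s≤s ())
e11-concat (suc j) b a a<2^[j+1] with halves a
... | twice q = begin
  e11 (b * 2 ^ suc (suc j) + q * 2)   ≡⟨ cong e11 (shift (2 ^ j) b q) ⟩
  e11 ((b * 2 ^ suc j + q) * 2)       ≡⟨ e11-double (b * 2 ^ suc j + q) ⟩
  e11 (b * 2 ^ suc j + q)             ≡⟨ e11-concat j b q (q*2<2*p⇒q<p q (2 ^ j) a<2^[j+1]) ⟩
  e11 b + e11 q                       ≡⟨ cong (e11 b +_) (e11-double q) ⟨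
  e11 b + e11 (q * 2)                 ∎
  where
  shift : ∀ p b q → b * (2 * (2 * p)) + q * 2 ≡ (b * (2 * p) + q) * 2
  shift = solve-∀
... | twice+1 q = begin
  e11 (b * 2 ^ suc (suc j) + (1 + q * 2))   ≡⟨ cong e11 (shift (2 ^ j) b q) ⟩
  e11 (1 + (b * 2 ^ suc j + q) * 2)         ≡⟨ e11-double+1 (b * 2 ^ suc j + q) ⟩
  (b * 2 ^ suc j + q) % 2 + e11 (b * 2 ^ suc j + q)
                                            ≡⟨ cong₂ _+_ low-bit (e11-concat j b q (q*2<2*p⇒q<p q (2 ^ j) (<⇒≤ a<2^[j+1]))) ⟩
  q % 2 + (e11 b + e11 q)                   ≡⟨ x∙yz≈y∙xz (q % 2) (e11 b) (e11 q) ⟩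
  e11 b + (q % 2 + e11 q)                   ≡⟨ cong (e11 b +_) (e11-double+1 q) ⟨
  e11 b + e11 (1 + q * 2)                   ∎
  where
  shift : ∀ p b q → b * (2 * (2 * p)) + (1 + q * 2) ≡ 1 + (b * (2 * p) + q) * 2
  shift = solve-∀
  low-bit : (b * 2 ^ suc j + q) % 2 ≡ q % 2
  low-bit = begin
    (b * 2 ^ suc j + q) % 2    ≡⟨ cong (_% 2) (swap b (2 ^ j) q) ⟩
    (q + b * 2 ^ j * 2) % 2    ≡⟨ [m+kn]%n≡m%n q (b * 2 ^ j) 2 ⟩
    q % 2                      ∎
    where
    swap : ∀ b p q → b * (2 * p) + q ≡ q + b * p * 2
    swap = solve-∀

r[l*[2^[j+1]+1]]≡0 : ∀ j l → l < 2 ^ j → r (l * (2 ^ suc j + 1)) ≡ 0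
r[l*[2^[j+1]+1]]≡0 j l l<2^j = begin
  e11 (l * (2 ^ suc j + 1)) % 2   ≡⟨ cong (λ n → e11 n % 2) (*-distribˡ-+ l (2 ^ suc j) 1) ⟩
  e11 (l * 2 ^ suc j + l * 1) % 2 ≡⟨ cong (λ n → e11 (l * 2 ^ suc j + n) % 2) (*-identityʳ l) ⟩
  e11 (l * 2 ^ suc j + l) % 2     ≡⟨ cong (_% 2) (e11-concat j l l l<2^j) ⟩
  (e11 l + e11 l) % 2             ≡⟨ cong (_% 2) (x+x≡x*2 (e11 l)) ⟩
  e11 l * 2 % 2                   ≡⟨ [q*2]%2≡0 (e11 l) ⟩
  0                               ∎
  where
  x+x≡x*2 : ∀ x → x + x ≡ x * 2
  x+x≡x*2 = solve-∀

e11[2^j*[2^[j+1]+1]]≡0 : ∀ j → 1 ≤ j → e11 (2 ^ j * (2 ^ suc j + 1)) ≡ 0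
e11[2^j*[2^[j+1]+1]]≡0 j 1≤j = begin
  e11 (2 ^ j * (2 ^ suc j + 1))   ≡⟨ e11-2^* j (2 ^ suc j + 1) ⟩
  e11 (2 ^ suc j + 1)             ≡⟨ cong (λ n → e11 (n + 1)) (*-identityˡ (2 ^ suc j)) ⟨
  e11 (1 * 2 ^ suc j + 1)         ≡⟨ e11-concat j 1 1 (^-monoʳ-< 2 (s≤s (s≤s z≤n)) 1≤j) ⟩
  0                               ∎

e11[[1+2^j]*[2^[j+1]+1]]≡1 : ∀ j → 2 ≤ j → e11 ((1 + 2 ^ j) * (2 ^ suc j + 1)) ≡ 1
e11[[1+2^j]*[2^[j+1]+1]]≡1 j 2≤j@(s≤s (s≤s {n = i} _)) = begin
  e11 ((1 + 2 ^ j) * (2 ^ suc j + 1))     ≡⟨ cong e11 (expand (2 ^ i)) ⟩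
  e11 (1 + 2 ^ i * Y * 2 * 2)             ≡⟨ e11-double+1 (2 ^ i * Y * 2) ⟩
  2 ^ i * Y * 2 % 2 + e11 (2 ^ i * Y * 2) ≡⟨ cong₂ _+_ ([q*2]%2≡0 (2 ^ i * Y)) (e11-double (2 ^ i * Y)) ⟩
  e11 (2 ^ i * Y)                         ≡⟨ e11-2^* i Y ⟩
  e11 (1 * 2 ^ suc j + 3)                 ≡⟨ e11-concat j 1 3 (^-monoʳ-≤ 2 2≤j) ⟩
  1                                       ∎
  where
  Y = 1 * 2 ^ suc j + 3
  expand : ∀ p → (1 + 2 * (2 * p)) * (2 * (2 * (2 * p)) + 1) ≡ 1 + p * (1 * (2 * (2 * (2 * p))) + 3) * 2 * 2
  expand = solve-∀

[2^[j+1]+2]/2≡1+2^j : ∀ j → (2 ^ suc j + 1 + 1) / 2 ≡ 1 + 2 ^ j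
[2^[j+1]+2]/2≡1+2^j j = trans (cong (_/ 2) (factor (2 ^ j))) ([q*2]/2≡q (1 + 2 ^ j))
  where
  factor : ∀ p → 2 * p + 1 + 1 ≡ (1 + p) * 2
  factor = solve-∀

proposition3p2 : ∀ (k : ℕ) → 2 ≤ k → IsA0 (2 ^ k + 1) ((2 ^ k + 1 + 1) / 2)
proposition3p2 _ (s≤s (s≤s {n = zero} _)) = s≤s z≤n , (λ ()) , λ where
  1 _ _ → refl
  2 _ _ → refl
  (suc (suc (suc _))) _ (s≤s (s≤s (s≤s ())))
proposition3p2 (suc j) (s≤s (s≤s {n = suc _} _))
  rewrite [2^[j+1]+2]/2≡1+2^j j = s≤s z≤n , flips-at-1+2^j , constant-below
  where
  flips-at-1+2^j : ¬ r ((1 + 2 ^ j) * (2 ^ suc j + 1)) ≡ 0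
  flips-at-1+2^j r≡0 = contradiction (trans (sym r≡1) r≡0) λ ()
    where
    r≡1 : r ((1 + 2 ^ j) * (2 ^ suc j + 1)) ≡ 1
    r≡1 = cong (_% 2) (e11[[1+2^j]*[2^[j+1]+1]]≡1 j (s≤s (s≤s z≤n)))
  constant-below : ∀ l → 1 ≤ l → l < 1 + 2 ^ j → r (l * (2 ^ suc j + 1)) ≡ 0
  constant-below l _ (s≤s l≤2^j) with m≤n⇒m<n∨m≡n l≤2^j
  ... | inj₁ l<2^j = r[l*[2^[j+1]+1]]≡0 j l l<2^j
  ... | inj₂ refl  = cong (_% 2) (e11[2^j*[2^[j+1]+1]]≡0 j (s≤s z≤n))
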